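{- Let $A$ and $B$ be finite conjunctions of weak linear inequalities $0\le t$ over the rationals, and let $P$ be an $\mathcal{LA}(\mathbb Q)$-proof of unsatisfiability of $A\wedge B$. Let $P'$ be obtained from $P$ by replacing each leaf inequality of $B$ with $(0\le 0)$. Associate to each node of $P'$ a list of pairs $\langle c, 0\le s\rangle$ (coefficient, inequality) as follows: a leaf with atom $0\le s$ gets the list $\langle 1, 0\le s\rangle$; for an inner node obtained by combining premises with lists $l_1,l_2$ using coefficients $c_1,c_2$, (1) concatenate $l_1$ and $l_2$, (2) multiply the coefficient of each pair coming from $l_1$ by $c_1$ and of each pair coming from $l_2$ by $c_2$, and (3) while there is an $A$-local variable $x$ occurring in the inequalities of more than one pair, remove all pairs $\langle c'_i, 0\le s_i\rangle$ whose inequality contains $x$ and add the single pair $\langle 1, 0\le \sum_i c'_i s_i\rangle$. Let $\langle c_1, 0\le t_1\rangle,\dots,\langle c_n,0\le t_n\rangle$ be the list associated with the root of $P'$. Then $I = \bigwedge_{i=1}^n (0\le t_i)$ is an interpolant for $(A,B)$. Moreover, $I$ is stronger than or equal to the interpolant obtained by the standard proof-based method from the same proof, i.e. $I$ entails it.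
   Context: An $\mathcal{LA}(\mathbb Q)$-proof of unsatisfiability is a derivation tree whose leaves are input atoms, whose inner nodes are obtained by the rule "from $0\le t_1$ and $0\le t_2$ derive $0\le c_1 t_1 + c_2 t_2$ with rational $c_1,c_2>0$", and whose root is $0\le c$ for a negative constant $c$. A variable is $A$-local if it occurs in $A$ but not in $B$. An interpolant for $(A,B)$ is a formula $I$ with $A\models I$, $I\wedge B$ unsatisfiable over $\mathbb Q$, and all variables of $I$ occurring in both $A$ and $B$. The standard proof-based method returns the single inequality at the root of $P'$. -}

module Defs where

open import Data.Nat as ℕ using (ℕ; zero; suc)
open import Data.Fin as F using (Fin)
open import Data.Rational using (ℚ; 0ℚ; 1ℚ; _+_; _*_; _≤_; _<_; Positive; _≟_)
open import Data.Vec as Vec using (Vec; []; _∷_; lookup; zipWith; replicate)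
open import Data.List as List using (List; []; _∷_; _++_; [_]; filter; length)
open import Data.List.Relation.Unary.All using (All)
open import Data.List.Relation.Unary.Any using (Any)
open import Data.List.Membership.Propositional using (_∈_)
open import Data.Product using (_×_; _,_; proj₁; proj₂)
open import Relation.Nullary using (¬_; ¬?)
open import Relation.Unary using (Decidable)
open import Relation.Binary.PropositionalEquality using (_≡_)
open import Relation.Binary.Construct.Closure.ReflexiveTransitive using (Star)

-- A linear term  a₀·x₀ + … + a_{n-1}·x_{n-1} + k  over n rational variables.
-- The atom  0 ≤ t  is represented by the term t.
record Term (n : ℕ) : Set where
  constructor term
  field
    coeffs : Vec ℚ n
    const  : ℚ
open Term public

zeroTerm : ∀ {n} → Term n
zeroTerm {n} = term (replicate n 0ℚ) 0ℚ

scale : ∀ {n} → ℚ → Term n → Term n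
scale c (term a k) = term (Vec.map (c *_) a) (c * k)

add : ∀ {n} → Term n → Term n → Term n
add (term a k) (term b l) = term (zipWith _+_ a b) (k + l)

dot : ∀ {n} → Vec ℚ n → (Fin n → ℚ) → ℚ
dot []       v = 0ℚ
dot (a ∷ as) v = a * v F.zero + dot as (λ i → v (F.suc i))

eval : ∀ {n} → (Fin n → ℚ) → Term n → ℚ
eval v t = dot (coeffs t) v + const t

Holds : ∀ {n} → (Fin n → ℚ) → List (Term n) → Set
Holds v F = All (λ t → 0ℚ ≤ eval v t) F

Occurs : ∀ {n} → Fin n → Term n → Set
Occurs x t = ¬ (lookup (coeffs t) x ≡ 0ℚ)

OccursIn : ∀ {n} → Fin n → List (Term n) → Set
OccursIn x F = Any (Occurs x) F

ALocal : ∀ {n} → List (Term n) → List (Term n) → Fin n → Set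
ALocal A B x = OccursIn x A × ¬ OccursIn x B

Interpolant : ∀ {n} → List (Term n) → List (Term n) → List (Term n) → Set
Interpolant {n} A B I =
  (∀ (v : Fin n → ℚ) → Holds v A → Holds v I)
  × (∀ (v : Fin n → ℚ) → ¬ (Holds v I × Holds v B))
  × (∀ s → s ∈ I → ∀ x → Occurs x s → OccursIn x A × OccursIn x B)

IsNegConst : ∀ {n} → Term n → Set
IsNegConst t = (∀ i → lookup (coeffs t) i ≡ 0ℚ) × const t < 0ℚ

data Deriv {n} (A B : List (Term n)) : Term n → Set where
  leafA : ∀ {t} → t ∈ A → Deriv A B t
  leafB : ∀ {t} → t ∈ B → Deriv A B t
  node  : ∀ {t₁ t₂} (c₁ c₂ : ℚ) → Positive c₁ → Positive c₂ →
          Deriv A B t₁ → Deriv A B t₂ →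
          Deriv A B (add (scale c₁ t₁) (scale c₂ t₂))

-- The standard proof-based interpolant: root of P' (B-leaves replaced by 0 ≤ 0).
stdInterp : ∀ {n} {A B : List (Term n)} {t} → Deriv A B t → Term n
stdInterp (leafA {t} _) = t
stdInterp (leafB _)     = zeroTerm
stdInterp (node c₁ c₂ _ _ p q) = add (scale c₁ (stdInterp p)) (scale c₂ (stdInterp q))

Pairs : ℕ → Set
Pairs n = List (ℚ × Term n)

contains? : ∀ {n} (x : Fin n) → Decidable (λ (p : ℚ × Term n) → Occurs x (proj₂ p))
contains? x p = ¬? (lookup (coeffs (proj₂ p)) x ≟ 0ℚ)

notContains? : ∀ {n} (x : Fin n) → Decidable (λ (p : ℚ × Term n) → ¬ Occurs x (proj₂ p))
notContains? x p = ¬? (contains? x p)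

lincomb : ∀ {n} → Pairs n → Term n
lincomb []             = zeroTerm
lincomb ((c , s) ∷ l)  = add (scale c s) (lincomb l)

scaleCoeffs : ∀ {n} → ℚ → Pairs n → Pairs n
scaleCoeffs c = List.map (λ p → (c * proj₁ p , proj₂ p))

data MergeStep {n} (A B : List (Term n)) : Pairs n → Pairs n → Set where
  merge : ∀ {l} (x : Fin n) → ALocal A B x →
          2 ℕ.≤ length (filter (contains? x) l) →
          MergeStep A B l (filter (notContains? x) l ++ [ (1ℚ , lincomb (filter (contains? x) l)) ])

-- the while-loop has terminated: no A-local variable occurs in more than one pair
Saturated : ∀ {n} → List (Term n) → List (Term n) → Pairs n → Set
Saturated A B l = ∀ x → ALocal A B x → length (filter (contains? x) l) ℕ.≤ 1

-- Assoc P l : l is (a possible outcome of) the list associated with the root of P'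
data Assoc {n} (A B : List (Term n)) : ∀ {t} → Deriv A B t → Pairs n → Set where
  aLeafA : ∀ {t} (m : t ∈ A) → Assoc A B (leafA m) [ (1ℚ , t) ]
  aLeafB : ∀ {t} (m : t ∈ B) → Assoc A B (leafB m) [ (1ℚ , zeroTerm) ]
  aNode  : ∀ {t₁ t₂ c₁ c₂ h₁ h₂} {p : Deriv A B t₁} {q : Deriv A B t₂} {l₁ l₂ l} →
           Assoc A B p l₁ → Assoc A B q l₂ →
           Star (MergeStep A B) (scaleCoeffs c₁ l₁ ++ scaleCoeffs c₂ l₂) l →
           Saturated A B l →
           Assoc A B (node c₁ c₂ h₁ h₂ p q) l

module Submission where

-- Every pair ⟨c, 0 ≤ s⟩ ever produced has c > 0 and an inequality 0 ≤ s that A entails and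
-- that mentions only variables of A.  A merge replaces some pairs by their own weighted sum,
-- so at every node Σ cᵢ sᵢ is exactly the standard interpolant of that node; hence I entails
-- the standard interpolant, which refutes B because together with the B-leaves it adds up to
-- the root 0 ≤ c < 0.  At the root an A-local x has the same coefficient in Σ cᵢ tᵢ as in
-- the constant c (B-leaves do not mention x), namely 0; after saturation at most one pair
-- contains x, and its positive weight rules out cancellation, so no inequality of I mentions x.

open import Defs
open import Data.Fin using (Fin)
open import Data.Rational using (ℚ; 0ℚ; _≤_)
open import Data.List using (List; map)
open import Data.Product using (_×_; ∃; proj₂)

open import Algebra.Bundles using (CommutativeMonoid)
open import Data.Empty using (⊥-elim)
open import Data.Nat as ℕ using (ℕ; suc; s≤s)
import Data.Nat.Induction as ℕInd
import Data.Nat.Properties as ℕP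
import Data.Fin as F
import Data.Fin.Properties as FP
open import Data.Rational using (1ℚ; _+_; _*_; _<_; Positive; _≟_)
import Data.Rational.Properties as ℚP
open import Data.Vec using (Vec; []; _∷_; lookup; zipWith; replicate)
import Data.Vec as Vec
import Data.Vec.Properties as VecP
open import Data.List using ([]; _∷_; _++_; [_]; filter; length)
open import Data.List.Properties using (length-++; length-filter)
open import Data.List.Relation.Unary.All as All using (All; []; _∷_)
import Data.List.Relation.Unary.All.Properties as AllP
open import Data.List.Relation.Unary.Any as Any using (here)
open import Data.List.Membership.Propositional using (_∈_; lose)
open import Data.List.Membership.Propositional.Properties using (∈-filter⁺; ∈-map⁻)
open import Data.Product using (_,_; proj₁)
open import Function using (_on_)
open import Induction.WellFounded using (Acc; acc)
open import Relation.Binary.Construct.On using (wellFounded)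
open import Relation.Nullary using (¬_; ¬?; yes; no)
open import Relation.Nullary.Decidable using (_×-dec_; decidable-stable)
open import Relation.Unary using (Decidable)
open import Relation.Binary.PropositionalEquality
  using (_≡_; refl; sym; trans; cong; cong₂; subst; subst₂; module ≡-Reasoning)
open import Relation.Binary.Construct.Closure.ReflexiveTransitive using (Star; ε; _◅_)
open import Algebra.Properties.CommutativeSemigroup
  (CommutativeMonoid.commutativeSemigroup ℚP.+-0-commutativeMonoid)
  using (interchange; x∙yz≈y∙xz)

dot-zipWith-+ : ∀ {n} (a b : Vec ℚ n) v → dot (zipWith _+_ a b) v ≡ dot a v + dot b v
dot-zipWith-+ []       []       v = sym (ℚP.+-identityʳ 0ℚ)
dot-zipWith-+ (a ∷ as) (b ∷ bs) v = trans
  (cong₂ _+_ (ℚP.*-distribʳ-+ (v F.zero) a b) (dot-zipWith-+ as bs v′))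
  (interchange (a * v F.zero) (b * v F.zero) (dot as v′) (dot bs v′))
  where v′ = λ i → v (F.suc i)

dot-map-* : ∀ {n} c (a : Vec ℚ n) v → dot (Vec.map (c *_) a) v ≡ c * dot a v
dot-map-* c []       v = sym (ℚP.*-zeroʳ c)
dot-map-* c (a ∷ as) v = trans
  (cong₂ _+_ (ℚP.*-assoc c a (v F.zero)) (dot-map-* c as (λ i → v (F.suc i))))
  (sym (ℚP.*-distribˡ-+ c _ _))

dot-zeros : ∀ {n} (a : Vec ℚ n) v → (∀ i → lookup a i ≡ 0ℚ) → dot a v ≡ 0ℚ
dot-zeros []       v a≡0 = refl
dot-zeros (a ∷ as) v a≡0 = cong₂ _+_
  (trans (cong (_* v F.zero) (a≡0 F.zero)) (ℚP.*-zeroˡ (v F.zero)))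
  (dot-zeros as (λ i → v (F.suc i)) (λ i → a≡0 (F.suc i)))

record LinearFunctional (n : ℕ) : Set where
  field
    apply          : Term n → ℚ
    apply-add      : ∀ s t → apply (add s t) ≡ apply s + apply t
    apply-scale    : ∀ c t → apply (scale c t) ≡ c * apply t
    apply-zeroTerm : apply zeroTerm ≡ 0ℚ

  apply-combination : ∀ c₁ c₂ s t →
    apply (add (scale c₁ s) (scale c₂ t)) ≡ c₁ * apply s + c₂ * apply t
  apply-combination c₁ c₂ s t =
    trans (apply-add _ _) (cong₂ _+_ (apply-scale c₁ s) (apply-scale c₂ t))
open LinearFunctional

evaluation : ∀ {n} → (Fin n → ℚ) → LinearFunctional n
evaluation v .apply = eval v
evaluation v .apply-add (term a k) (term b l) =
  trans (cong (_+ (k + l)) (dot-zipWith-+ a b v)) (interchange (dot a v) (dot b v) k l)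
evaluation v .apply-scale c (term a k) =
  trans (cong (_+ c * k) (dot-map-* c a v)) (sym (ℚP.*-distribˡ-+ c _ k))
evaluation {n} v .apply-zeroTerm =
  cong (_+ 0ℚ) (dot-zeros (replicate n 0ℚ) v (λ i → VecP.lookup-replicate i 0ℚ))

coefficient : ∀ {n} → Fin n → LinearFunctional n
coefficient x .apply t = lookup (coeffs t) x
coefficient x .apply-add (term a k) (term b l) = VecP.lookup-zipWith _+_ x a b
coefficient x .apply-scale c (term a k) = VecP.lookup-map x (c *_) a
coefficient x .apply-zeroTerm = VecP.lookup-replicate x 0ℚ

eval-negConst : ∀ {n} {t : Term n} → IsNegConst t → ∀ v → eval v t < 0ℚ
eval-negConst {t = t} (noVars , c<0) v =
  subst (_< 0ℚ) (sym (trans (cong (_+ const t) (dot-zeros (coeffs t) v noVars))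
                            (ℚP.+-identityˡ (const t))))
        c<0

weightedSum : ∀ {n} → (Term n → ℚ) → Pairs n → ℚ
weightedSum g []            = 0ℚ
weightedSum g ((c , s) ∷ l) = c * g s + weightedSum g l

pos*≡0⇒≡0 : ∀ c a → Positive c → c * a ≡ 0ℚ → a ≡ 0ℚ
pos*≡0⇒≡0 c a c>0 ca≡0 = ℚP.≤-antisym
  (ℚP.*-cancelˡ-≤-pos c {{c>0}} (ℚP.≤-reflexive (trans ca≡0 (sym (ℚP.*-zeroʳ c)))))
  (ℚP.*-cancelˡ-≤-pos c {{c>0}} (ℚP.≤-reflexive (trans (ℚP.*-zeroʳ c) (sym ca≡0))))

pos*nonNeg⇒nonNeg : ∀ c a → Positive c → 0ℚ ≤ a → 0ℚ ≤ c * a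
pos*nonNeg⇒nonNeg c a c>0 a≥0 = subst (_≤ c * a) (ℚP.*-zeroʳ c)
  (ℚP.*-monoˡ-≤-nonNeg c {{ℚP.pos⇒nonNeg c {{c>0}}}} a≥0)

module _ {n : ℕ} (g : Term n → ℚ) where

  weightedSum-++ : ∀ l₁ l₂ → weightedSum g (l₁ ++ l₂) ≡ weightedSum g l₁ + weightedSum g l₂
  weightedSum-++ []             l₂ = sym (ℚP.+-identityˡ _)
  weightedSum-++ ((c , s) ∷ l₁) l₂ =
    trans (cong (c * g s +_) (weightedSum-++ l₁ l₂))
          (sym (ℚP.+-assoc (c * g s) (weightedSum g l₁) (weightedSum g l₂)))

  weightedSum-scaleCoeffs : ∀ d l → weightedSum g (scaleCoeffs d l) ≡ d * weightedSum g l
  weightedSum-scaleCoeffs d []            = sym (ℚP.*-zeroʳ d)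
  weightedSum-scaleCoeffs d ((c , s) ∷ l) = trans
    (cong₂ _+_ (ℚP.*-assoc d c (g s)) (weightedSum-scaleCoeffs d l))
    (sym (ℚP.*-distribˡ-+ d _ _))

  weightedSum-filter : ∀ {P : ℚ × Term n → Set} (P? : Decidable P) l →
    weightedSum g l ≡ weightedSum g (filter P? l) + weightedSum g (filter (λ p → ¬? (P? p)) l)
  weightedSum-filter P? [] = refl
  weightedSum-filter P? ((c , s) ∷ l) with P? (c , s)
  ... | yes _ = trans (cong (c * g s +_) (weightedSum-filter P? l))
                      (sym (ℚP.+-assoc (c * g s) (weightedSum g (filter P? l)) _))
  ... | no  _ = trans (cong (c * g s +_) (weightedSum-filter P? l))
                      (x∙yz≈y∙xz (c * g s) (weightedSum g (filter P? l)) _)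

  weightedSum-nonNeg : ∀ l → All (λ p → Positive (proj₁ p)) l →
    All (λ p → 0ℚ ≤ g (proj₂ p)) l → 0ℚ ≤ weightedSum g l
  weightedSum-nonNeg []            []          []          = ℚP.≤-refl
  weightedSum-nonNeg ((c , s) ∷ l) (c>0 ∷ c's) (s≥0 ∷ s's) =
    ℚP.+-mono-≤ (pos*nonNeg⇒nonNeg c (g s) c>0 s≥0) (weightedSum-nonNeg l c's s's)

  weightedSum-zeros : ∀ l → All (λ p → g (proj₂ p) ≡ 0ℚ) l → weightedSum g l ≡ 0ℚ
  weightedSum-zeros []            []          = refl
  weightedSum-zeros ((c , s) ∷ l) (s≡0 ∷ s's) =
    cong₂ _+_ (trans (cong (c *_) s≡0) (ℚP.*-zeroʳ c)) (weightedSum-zeros l s's)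

  weightedSum-single-zero : ∀ {p} {l : Pairs n} → length l ℕ.≤ 1 → p ∈ l →
    Positive (proj₁ p) → weightedSum g l ≡ 0ℚ → g (proj₂ p) ≡ 0ℚ
  weightedSum-single-zero {l = (c , s) ∷ []} _ (here refl) c>0 sum≡0 =
    pos*≡0⇒≡0 c (g s) c>0 (trans (sym (ℚP.+-identityʳ _)) sum≡0)
  weightedSum-single-zero {l = _ ∷ _ ∷ _}    (s≤s ()) _ _ _

module _ {n : ℕ} (L : LinearFunctional n) where

  apply-lincomb : ∀ l → apply L (lincomb l) ≡ weightedSum (apply L) l
  apply-lincomb []            = apply-zeroTerm L
  apply-lincomb ((c , s) ∷ l) =
    trans (apply-add L _ _) (cong₂ _+_ (apply-scale L c s) (apply-lincomb l))

  weightedSum-mergeStep : ∀ {A B : List (Term n)} {l l'} → MergeStep A B l l' →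
    weightedSum (apply L) l' ≡ weightedSum (apply L) l
  weightedSum-mergeStep (merge {l} x _ _) = begin
    weightedSum g (out ++ [ (1ℚ , lincomb into) ])
      ≡⟨ weightedSum-++ g out _ ⟩
    weightedSum g out + (1ℚ * g (lincomb into) + 0ℚ)
      ≡⟨ cong (λ z → weightedSum g out + z)
              (trans (ℚP.+-identityʳ _) (trans (ℚP.*-identityˡ _) (apply-lincomb into))) ⟩
    weightedSum g out + weightedSum g into
      ≡⟨ ℚP.+-comm (weightedSum g out) (weightedSum g into) ⟩
    weightedSum g into + weightedSum g out
      ≡⟨ sym (weightedSum-filter g (contains? x) l) ⟩
    weightedSum g l ∎
    where
      open ≡-Reasoning
      g = apply L
      into = filter (contains? x) l
      out = filter (notContains? x) l

  weightedSum-merges : ∀ {A B : List (Term n)} {l l'} → Star (MergeStep A B) l l' →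
    weightedSum (apply L) l' ≡ weightedSum (apply L) l
  weightedSum-merges ε            = refl
  weightedSum-merges (step ◅ steps) = trans (weightedSum-merges steps) (weightedSum-mergeStep step)

  weightedSum-Assoc : ∀ {A B : List (Term n)} {t} {P : Deriv A B t} {l} → Assoc A B P l →
    weightedSum (apply L) l ≡ apply L (stdInterp P)
  weightedSum-Assoc (aLeafA {t} _) = trans (ℚP.+-identityʳ _) (ℚP.*-identityˡ (apply L t))
  weightedSum-Assoc (aLeafB _)     = trans (ℚP.+-identityʳ _) (ℚP.*-identityˡ _)
  weightedSum-Assoc (aNode {c₁ = c₁} {c₂} {p = p} {q} {l₁} {l₂} {l} assoc₁ assoc₂ steps _) = begin
    weightedSum g l
      ≡⟨ weightedSum-merges steps ⟩
    weightedSum g (scaleCoeffs c₁ l₁ ++ scaleCoeffs c₂ l₂)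
      ≡⟨ weightedSum-++ g (scaleCoeffs c₁ l₁) (scaleCoeffs c₂ l₂) ⟩
    weightedSum g (scaleCoeffs c₁ l₁) + weightedSum g (scaleCoeffs c₂ l₂)
      ≡⟨ cong₂ _+_ (weightedSum-scaleCoeffs g c₁ l₁) (weightedSum-scaleCoeffs g c₂ l₂) ⟩
    c₁ * weightedSum g l₁ + c₂ * weightedSum g l₂
      ≡⟨ cong₂ (λ a b → c₁ * a + c₂ * b) (weightedSum-Assoc assoc₁) (weightedSum-Assoc assoc₂) ⟩
    c₁ * g (stdInterp p) + c₂ * g (stdInterp q)
      ≡⟨ sym (apply-combination L c₁ c₂ (stdInterp p) (stdInterp q)) ⟩
    g (add (scale c₁ (stdInterp p)) (scale c₂ (stdInterp q))) ∎
    where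
      open ≡-Reasoning
      g = apply L

record AConsequence {n} (A : List (Term n)) (p : ℚ × Term n) : Set where
  field
    weight-pos : Positive (proj₁ p)
    entailed   : ∀ v → Holds v A → 0ℚ ≤ eval v (proj₂ p)
    vars-of-A  : ∀ x → ¬ OccursIn x A → lookup (coeffs (proj₂ p)) x ≡ 0ℚ
open AConsequence

module _ {n} {A : List (Term n)} where

  lincomb-AConsequence : ∀ {l} → All (AConsequence A) l → AConsequence A (1ℚ , lincomb l)
  lincomb-AConsequence {l} cs .weight-pos = _
  lincomb-AConsequence {l} cs .entailed v ⊨A =
    subst (0ℚ ≤_) (sym (apply-lincomb (evaluation v) l))
      (weightedSum-nonNeg (eval v) l (All.map weight-pos cs) (All.map (λ c → entailed c v ⊨A) cs))
  lincomb-AConsequence {l} cs .vars-of-A x x∉A =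
    trans (apply-lincomb (coefficient x) l)
      (weightedSum-zeros (apply (coefficient x)) l (All.map (λ c → vars-of-A c x x∉A) cs))

  scaleCoeffs-AConsequence : ∀ c → Positive c → ∀ {l} →
    All (AConsequence A) l → All (AConsequence A) (scaleCoeffs c l)
  scaleCoeffs-AConsequence c c>0 []         = []
  scaleCoeffs-AConsequence c c>0 (cp ∷ cps) =
    record { weight-pos = ℚP.pos*pos⇒pos c {{c>0}} _ {{weight-pos cp}}
           ; entailed   = entailed cp
           ; vars-of-A  = vars-of-A cp }
      ∷ scaleCoeffs-AConsequence c c>0 cps

  merges-AConsequence : ∀ {B l l'} → Star (MergeStep A B) l l' →
    All (AConsequence A) l → All (AConsequence A) l'
  merges-AConsequence ε cs = cs
  merges-AConsequence (merge {l} x _ _ ◅ steps) cs = merges-AConsequence steps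
    (AllP.++⁺ (AllP.filter⁺ (notContains? x) cs)
              (lincomb-AConsequence (AllP.filter⁺ (contains? x) cs) ∷ []))

  Assoc-AConsequence : ∀ {B t} {P : Deriv A B t} {l} → Assoc A B P l → All (AConsequence A) l
  Assoc-AConsequence (aLeafA t∈A) = record
    { weight-pos = _
    ; entailed   = λ v ⊨A → All.lookup ⊨A t∈A
    ; vars-of-A  = λ x x∉A → decidable-stable (_ ≟ 0ℚ) (λ x∈t → x∉A (lose t∈A x∈t))
    } ∷ []
  Assoc-AConsequence (aLeafB _) = record
    { weight-pos = _
    ; entailed   = λ v _ → ℚP.≤-reflexive (sym (apply-zeroTerm (evaluation v)))
    ; vars-of-A  = λ x _ → apply-zeroTerm (coefficient x)
    } ∷ []
  Assoc-AConsequence (aNode {c₁ = c₁} {c₂} {h₁} {h₂} assoc₁ assoc₂ steps _) =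
    merges-AConsequence steps
      (AllP.++⁺ (scaleCoeffs-AConsequence c₁ h₁ (Assoc-AConsequence assoc₁))
                (scaleCoeffs-AConsequence c₂ h₂ (Assoc-AConsequence assoc₂)))

occursIn? : ∀ {n} (x : Fin n) → Decidable (OccursIn x)
occursIn? x = Any.any? (λ t → ¬? (lookup (coeffs t) x ≟ 0ℚ))

length-filter-+-∁ : ∀ {X : Set} {P : X → Set} (P? : Decidable P) xs →
  length (filter P? xs) ℕ.+ length (filter (λ x → ¬? (P? x)) xs) ≡ length xs
length-filter-+-∁ P? [] = refl
length-filter-+-∁ P? (x ∷ xs) with P? x
... | yes _ = cong suc (length-filter-+-∁ P? xs)
... | no  _ = trans (ℕP.+-suc _ _) (cong suc (length-filter-+-∁ P? xs))

module _ {n} (A B : List (Term n)) where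

  mergeOn : Fin n → Pairs n → Pairs n
  mergeOn x l = filter (notContains? x) l ++ [ (1ℚ , lincomb (filter (contains? x) l)) ]

  Mergeable : Pairs n → Fin n → Set
  Mergeable l x = ALocal A B x × 2 ℕ.≤ length (filter (contains? x) l)

  mergeable? : ∀ l → Decidable (Mergeable l)
  mergeable? l x =
    (occursIn? x A ×-dec ¬? (occursIn? x B)) ×-dec (2 ℕ.≤? length (filter (contains? x) l))

  mergeOn-shorter : ∀ x l → 2 ℕ.≤ length (filter (contains? x) l) →
    length (mergeOn x l) ℕ.< length l
  mergeOn-shorter x l twice = begin-strict
    length (out ++ _)                 ≡⟨ length-++ out ⟩
    length out ℕ.+ 1                  ≡⟨ ℕP.+-comm (length out) 1 ⟩
    1 ℕ.+ length out                  <⟨ ℕP.+-monoˡ-≤ (length out) twice ⟩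
    length into ℕ.+ length out        ≡⟨ length-filter-+-∁ (contains? x) l ⟩
    length l                          ∎
    where
      open ℕP.≤-Reasoning
      into = filter (contains? x) l
      out  = filter (notContains? x) l

  saturate : ∀ l → Acc (ℕ._<_ on length) l →
    ∃ λ l' → Star (MergeStep A B) l l' × Saturated A B l'
  saturate l (acc shorter) with FP.any? (mergeable? l)
  ... | yes (x , local , twice) =
    let (l' , steps , saturated) = saturate (mergeOn x l) (shorter (mergeOn-shorter x l twice))
    in  l' , merge x local twice ◅ steps , saturated
  ... | no none = l , ε , λ x local → ℕP.≤-pred (ℕP.≰⇒> (λ twice → none (x , local , twice)))

  Assoc-exists : ∀ {t} (P : Deriv A B t) → ∃ (Assoc A B P)
  Assoc-exists (leafA t∈A) = _ , aLeafA t∈A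
  Assoc-exists (leafB t∈B) = _ , aLeafB t∈B
  Assoc-exists (node c₁ c₂ _ _ p q) =
    let (l₁ , assoc₁) = Assoc-exists p
        (l₂ , assoc₂) = Assoc-exists q
        l = scaleCoeffs c₁ l₁ ++ scaleCoeffs c₂ l₂
        (l' , steps , saturated) = saturate l (wellFounded length ℕInd.<-wellFounded l)
    in  l' , aNode assoc₁ assoc₂ steps saturated

module _ {n} {A B : List (Term n)} where

  stdInterp-≤ : ∀ {t} (P : Deriv A B t) v → Holds v B → eval v (stdInterp P) ≤ eval v t
  stdInterp-≤ (leafA _)     v _  = ℚP.≤-refl
  stdInterp-≤ (leafB {t} t∈B) v ⊨B =
    subst (_≤ eval v t) (sym (apply-zeroTerm (evaluation v))) (All.lookup ⊨B t∈B)
  stdInterp-≤ (node {t₁} {t₂} c₁ c₂ h₁ h₂ p q) v ⊨B =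
    subst₂ _≤_ (sym (apply-combination (evaluation v) c₁ c₂ (stdInterp p) (stdInterp q)))
               (sym (apply-combination (evaluation v) c₁ c₂ t₁ t₂))
      (ℚP.+-mono-≤ (ℚP.*-monoˡ-≤-nonNeg c₁ {{ℚP.pos⇒nonNeg c₁ {{h₁}}}} (stdInterp-≤ p v ⊨B))
                   (ℚP.*-monoˡ-≤-nonNeg c₂ {{ℚP.pos⇒nonNeg c₂ {{h₂}}}} (stdInterp-≤ q v ⊨B)))

  stdInterp-refutes-B : ∀ {t} (P : Deriv A B t) → IsNegConst t → ∀ v → Holds v B →
    eval v (stdInterp P) < 0ℚ
  stdInterp-refutes-B {t} P neg v ⊨B =
    ℚP.≤-<-trans (stdInterp-≤ P v ⊨B) (eval-negConst {t = t} neg v)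

  stdInterp-coeff : ∀ x → ¬ OccursIn x B → ∀ {t} (P : Deriv A B t) →
    lookup (coeffs (stdInterp P)) x ≡ lookup (coeffs t) x
  stdInterp-coeff x x∉B (leafA _)   = refl
  stdInterp-coeff x x∉B (leafB t∈B) = trans (apply-zeroTerm (coefficient x))
    (sym (decidable-stable (_ ≟ 0ℚ) (λ x∈t → x∉B (lose t∈B x∈t))))
  stdInterp-coeff x x∉B (node {t₁} {t₂} c₁ c₂ _ _ p q) = begin
    apply cx (add (scale c₁ (stdInterp p)) (scale c₂ (stdInterp q)))
      ≡⟨ apply-combination cx c₁ c₂ (stdInterp p) (stdInterp q) ⟩
    c₁ * apply cx (stdInterp p) + c₂ * apply cx (stdInterp q)
      ≡⟨ cong₂ (λ a b → c₁ * a + c₂ * b) (stdInterp-coeff x x∉B p) (stdInterp-coeff x x∉B q) ⟩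
    c₁ * apply cx t₁ + c₂ * apply cx t₂
      ≡⟨ sym (apply-combination cx c₁ c₂ t₁ t₂) ⟩
    apply cx (add (scale c₁ t₁) (scale c₂ t₂)) ∎
    where
      open ≡-Reasoning
      cx = coefficient x

  Assoc-entails-stdInterp : ∀ {t} {P : Deriv A B t} {l} → Assoc A B P l →
    ∀ v → Holds v (map proj₂ l) → 0ℚ ≤ eval v (stdInterp P)
  Assoc-entails-stdInterp {l = l} assoc v ⊨l =
    subst (0ℚ ≤_) (weightedSum-Assoc (evaluation v) assoc)
      (weightedSum-nonNeg (eval v) l (All.map weight-pos (Assoc-AConsequence assoc)) (AllP.map⁻ ⊨l))

  Assoc-entails : ∀ {t} {P : Deriv A B t} {l} → Assoc A B P l →
    ∀ v → Holds v A → Holds v (map proj₂ l)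
  Assoc-entails assoc v ⊨A = AllP.map⁺ (All.map (λ c → entailed c v ⊨A) (Assoc-AConsequence assoc))

  Assoc-refutes-B : ∀ {t} {P : Deriv A B t} {l} → Assoc A B P l → IsNegConst t →
    ∀ v → ¬ (Holds v (map proj₂ l) × Holds v B)
  Assoc-refutes-B {P = P} assoc neg v (⊨l , ⊨B) = ℚP.<-irrefl refl
    (ℚP.≤-<-trans (Assoc-entails-stdInterp assoc v ⊨l) (stdInterp-refutes-B P neg v ⊨B))

module _ {n} {A B : List (Term n)} where

  Assoc-saturated : ∀ {t} {P : Deriv A B t} {l} → Assoc A B P l → Saturated A B l
  Assoc-saturated (aLeafA {t} _)    x _ = length-filter (contains? x) [ (1ℚ , t) ]
  Assoc-saturated (aLeafB _)        x _ = length-filter (contains? x) [ (1ℚ , zeroTerm) ]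
  Assoc-saturated (aNode _ _ _ sat) = sat

  Assoc-noALocal : ∀ {t} {P : Deriv A B t} {l} → Assoc A B P l → IsNegConst t →
    ∀ x → ALocal A B x → ∀ {p} → p ∈ l → ¬ Occurs x (proj₂ p)
  Assoc-noALocal {t} {P} {l} assoc (noVars , _) x (x∈A , x∉B) {p} p∈l x∈p =
    x∈p (weightedSum-single-zero cx (Assoc-saturated assoc x (x∈A , x∉B))
           (∈-filter⁺ (contains? x) p∈l x∈p)
           (weight-pos (All.lookup (Assoc-AConsequence assoc) p∈l))
           into-cancels)
    where
      open ≡-Reasoning
      cx = apply (coefficient x)
      into = filter (contains? x) l
      out  = filter (notContains? x) l
      into-cancels : weightedSum cx into ≡ 0ℚ
      into-cancels = begin
        weightedSum cx into                        ≡⟨ sym (ℚP.+-identityʳ _) ⟩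
        weightedSum cx into + 0ℚ                   ≡⟨ cong (weightedSum cx into +_) (sym
             (weightedSum-zeros cx out
               (All.map (decidable-stable (_ ≟ 0ℚ)) (AllP.all-filter (notContains? x) l)))) ⟩
        weightedSum cx into + weightedSum cx out   ≡⟨ sym (weightedSum-filter cx (contains? x) l) ⟩
        weightedSum cx l                           ≡⟨ weightedSum-Assoc (coefficient x) assoc ⟩
        cx (stdInterp P)                           ≡⟨ stdInterp-coeff x x∉B P ⟩
        cx t                                       ≡⟨ noVars x ⟩
        0ℚ                                         ∎

  Assoc-shared : ∀ {t} {P : Deriv A B t} {l} → Assoc A B P l → IsNegConst t →
    ∀ s → s ∈ map proj₂ l → ∀ x → Occurs x s → OccursIn x A × OccursIn x B
  Assoc-shared assoc neg s s∈ x x∈s with ∈-map⁻ proj₂ s∈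
  ... | p , p∈l , refl with occursIn? x A | occursIn? x B
  ... | no  x∉A | _       = ⊥-elim (x∈s (vars-of-A (All.lookup (Assoc-AConsequence assoc) p∈l) x x∉A))
  ... | yes x∈A | yes x∈B = x∈A , x∈B
  ... | yes x∈A | no  x∉B = ⊥-elim (Assoc-noALocal assoc neg x (x∈A , x∉B) p∈l x∈s)

mainTheorem5 : ∀ {n} (A B : List (Term n)) {t} (P : Deriv A B t) → IsNegConst t →
    (∃ λ L → Assoc A B P L)
    × (∀ L → Assoc A B P L →
         Interpolant A B (map proj₂ L)
         × (∀ (v : Fin n → ℚ) → Holds v (map proj₂ L) → 0ℚ ≤ eval v (stdInterp P)))
mainTheorem5 A B P neg = Assoc-exists A B P , λ L assoc →
  (Assoc-entails assoc , Assoc-refutes-B assoc neg , Assoc-shared assoc neg)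
  , Assoc-entails-stdInterp assoc
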